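{- As formal power series in $t$, \[ \sum_{n=0}^{\infty}Q_{n}(x)t^n=\frac{1+4xt+(1+2x)\sqrt{1+4xt}}{2(1+x-t)(1+4xt)}. \]
   Context: For each integer $n\geq 0$, $P_n(x),Q_n(x)\in\mathbb{Q}[x]$ denote the unique pair of polynomials with $\deg P_n\leq n$, $\deg Q_n\leq n$ satisfying $P_n(x)x^{n+1}+Q_n(x)(x+1)^{n+1}=1$. Here $\sqrt{1+4xt}$ denotes the power series in $t$ with constant term $1$ given by the binomial series. -}

module Defs where

open import Data.Nat as ℕ using (ℕ; zero; suc; _<_; _≟_)
open import Data.Integer using (+_)
open import Data.Rational using (ℚ; 0ℚ; 1ℚ; ½; _/_; _+_; _*_; _-_; -_)
open import Data.Product using (Σ; _×_)
open import Relation.Nullary using (yes; no)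
open import Relation.Binary.PropositionalEquality using (_≡_)

ℕ→ℚ : ℕ → ℚ
ℕ→ℚ n = + n / 1

sumTo : ℕ → (ℕ → ℚ) → ℚ
sumTo zero    f = f 0
sumTo (suc n) f = sumTo n f + f (suc n)

-- Polynomials in x over ℚ, as coefficient functions (p k = coeff of x^k)

Poly : Set
Poly = ℕ → ℚ

-- deg p ≤ n  (zero polynomial has every degree bound)
DegLe : Poly → ℕ → Set
DegLe p n = ∀ k → n < k → p k ≡ 0ℚ

_+ₚ_ : Poly → Poly → Poly
(p +ₚ q) k = p k + q k

_*ₚ_ : Poly → Poly → Poly
(p *ₚ q) k = sumTo k (λ i → p i * q (k ℕ.∸ i))

oneₚ : Poly
oneₚ zero    = 1ℚ
oneₚ (suc _) = 0ℚ

xₚ : Poly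
xₚ 1 = 1ℚ
xₚ _ = 0ℚ

_^ₚ_ : Poly → ℕ → Poly
p ^ₚ zero  = oneₚ
p ^ₚ suc m = p *ₚ (p ^ₚ m)

BezoutId : ℕ → Poly → Poly → Set
BezoutId n P Q = ∀ k →
  ((P *ₚ (xₚ ^ₚ suc n)) +ₚ (Q *ₚ ((xₚ +ₚ oneₚ) ^ₚ suc n))) k ≡ oneₚ k

IsPQ : ℕ → Poly → Poly → Set
IsPQ n P Q = DegLe P n × DegLe Q n × BezoutId n P Q

-- Formal power series in t with coefficients in ℚ[x], represented as
-- (embedded in) ℚ[[t,x]]:  F n k = coefficient of t^n x^k

Ser : Set
Ser = ℕ → ℕ → ℚ

_+ₛ_ : Ser → Ser → Ser
(F +ₛ G) n k = F n k + G n k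

_*ₛ_ : Ser → Ser → Ser
(F *ₛ G) n k = sumTo n (λ i → sumTo k (λ j → F i j * G (n ℕ.∸ i) (k ℕ.∸ j)))

constₛ : ℚ → Ser
constₛ c zero zero = c
constₛ c _    _    = 0ℚ

xₛ : Ser
xₛ 0 1 = 1ℚ
xₛ _ _ = 0ℚ

tₛ : Ser
tₛ 1 0 = 1ℚ
tₛ _ _ = 0ℚ

negₛ : Ser → Ser
negₛ F n k = - F n k

genFun : (ℕ → Poly) → Ser
genFun A n k = A n k

gbinom : ℚ → ℕ → ℚ
gbinom a zero    = 1ℚ
gbinom a (suc n) = gbinom a n * (a - ℕ→ℚ n) * (+ 1 / suc n)

_^ℚ_ : ℚ → ℕ → ℚ
q ^ℚ zero  = 1ℚ
q ^ℚ suc m = q * (q ^ℚ m)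

-- sqrt(1+4xt) := Σ_n binom(1/2, n) (4xt)^n  (binomial series);
-- coefficient of t^n x^k is binom(1/2,n) 4^n if k = n, else 0
sqrt1+4xt : Ser
sqrt1+4xt n k with n ≟ k
... | yes _ = gbinom ½ n * (ℕ→ℚ 4 ^ℚ n)
... | no  _ = 0ℚ

one+4xt : Ser
one+4xt = constₛ 1ℚ +ₛ (constₛ (ℕ→ℚ 4) *ₛ (xₛ *ₛ tₛ))

numer : Ser
numer = one+4xt +ₛ ((constₛ 1ℚ +ₛ (constₛ (ℕ→ℚ 2) *ₛ xₛ)) *ₛ sqrt1+4xt)

denom : Ser
denom = constₛ (ℕ→ℚ 2) *ₛ (((constₛ 1ℚ +ₛ xₛ) +ₛ negₛ tₛ) *ₛ one+4xt)

_≈ₛ_ : Ser → Ser → Set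
F ≈ₛ G = ∀ n k → F n k ≡ G n k

module Submission where

-- Q_n is the truncation to degree n of (1+x)^-(n+1) = Σ_k (-1)^k binom(n+k, k) x^k: both satisfy
-- Q (1+x)^(n+1) ≡ 1 mod x^(n+1), and (1+x)^(n+1) is a unit modulo x^(n+1).  For G = Σ_n Q_n t^n,
-- Pascal's rule makes (1+x-t) G collapse onto the diagonal: 2 (1+x-t) G = 1 + (1+2x) D with
-- D = Σ_n (-1)^n binom(2n, n) (xt)^n, and (1+4xt) D = sqrt(1+4xt) substCoefficienticientwise.  Multiplying by
-- 1+4xt gives 2 (1+x-t)(1+4xt) G = (1+4xt) + (1+2x) sqrt(1+4xt).

open import Defs
open import Level using (0ℓ)
open import Data.Nat as ℕ using (ℕ; zero; suc; _≤_; _<_; z≤n; s≤s; _∸_)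
import Data.Nat.Properties as ℕP
import Data.Integer as ℤ
import Data.Integer.Properties as ℤP
import Data.Nat.Coprimality as Coprimality
open import Data.Rational using (ℚ; mkℚ; 0ℚ; 1ℚ; ½; _/_; _+_; _*_; _-_; -_)
open import Data.Rational.Properties
open import Data.Product using (_,_)
open import Data.Sum using (inj₁; inj₂)
open import Relation.Nullary using (Dec; yes; no)
open import Relation.Binary.Definitions using (tri<; tri≈; tri>)
open import Function using (_∘_)
open import Relation.Nullary.Decidable using (dec⇒maybe)
open import Relation.Binary.PropositionalEquality
open import Data.Empty using (⊥-elim)
open import Algebra.Properties.Group +-0-group using (∙-cancelˡ; inverseʳ-unique)
open import Tactic.RingSolver using (solve-∀)
open import Tactic.RingSolver.Core.AlmostCommutativeRing using (AlmostCommutativeRing; fromCommutativeRing)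
open ≡-Reasoning

ℚ-ring : AlmostCommutativeRing 0ℓ 0ℓ
ℚ-ring = fromCommutativeRing +-*-commutativeRing (λ x → dec⇒maybe (0ℚ ≟ x))

sumTo-cong : ∀ n {f g : ℕ → ℚ} → (∀ i → i ≤ n → f i ≡ g i) → sumTo n f ≡ sumTo n g
sumTo-cong zero    f≡g = f≡g 0 z≤n
sumTo-cong (suc n) f≡g =
  cong₂ _+_ (sumTo-cong n (λ i i≤n → f≡g i (ℕP.m≤n⇒m≤1+n i≤n))) (f≡g (suc n) ℕP.≤-refl)

sumTo-+ : ∀ n (f g : ℕ → ℚ) → sumTo n (λ i → f i + g i) ≡ sumTo n f + sumTo n g
sumTo-+ zero    f g = refl
sumTo-+ (suc n) f g =
  trans (cong (_+ (f (suc n) + g (suc n))) (sumTo-+ n f g))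
        (interchange (sumTo n f) (sumTo n g) (f (suc n)) (g (suc n)))
  where
  interchange : ∀ a b c d → (a + b) + (c + d) ≡ (a + c) + (b + d)
  interchange = solve-∀ ℚ-ring

sumTo-*ˡ : ∀ n c (f : ℕ → ℚ) → sumTo n (λ i → c * f i) ≡ c * sumTo n f
sumTo-*ˡ zero    c f = refl
sumTo-*ˡ (suc n) c f =
  trans (cong (_+ c * f (suc n)) (sumTo-*ˡ n c f)) (sym (*-distribˡ-+ c _ _))

sumTo-neg : ∀ n (f : ℕ → ℚ) → sumTo n (λ i → - f i) ≡ - sumTo n f
sumTo-neg zero    f = refl
sumTo-neg (suc n) f =
  trans (cong (_+ - f (suc n)) (sumTo-neg n f)) (sym (neg-distrib-+ (sumTo n f) _))

sumTo-zero : ∀ n {f : ℕ → ℚ} → (∀ i → i ≤ n → f i ≡ 0ℚ) → sumTo n f ≡ 0ℚ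
sumTo-zero zero    f≡0 = f≡0 0 z≤n
sumTo-zero (suc n) f≡0 =
  cong₂ _+_ (sumTo-zero n (λ i i≤n → f≡0 i (ℕP.m≤n⇒m≤1+n i≤n))) (f≡0 (suc n) ℕP.≤-refl)

sumTo-suc : ∀ n (f : ℕ → ℚ) → sumTo (suc n) f ≡ f 0 + sumTo n (f ∘ suc)
sumTo-suc zero    f = refl
sumTo-suc (suc n) f =
  trans (cong (_+ f (suc (suc n))) (sumTo-suc n f)) (+-assoc (f 0) _ _)

sumTo-suc-0 : ∀ n (f : ℕ → ℚ) → f 0 ≡ 0ℚ → sumTo (suc n) f ≡ sumTo n (f ∘ suc)
sumTo-suc-0 n f f0≡0 =
  trans (sumTo-suc n f) (trans (cong (_+ sumTo n (f ∘ suc)) f0≡0) (+-identityˡ _))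

sumTo-∸-suc : ∀ n (g : ℕ → ℕ → ℚ) → (∀ i → g i 0 ≡ 0ℚ) →
              sumTo (suc n) (λ i → g i (suc n ∸ i)) ≡ sumTo n (λ i → g i (suc (n ∸ i)))
sumTo-∸-suc n g g0≡0 = begin
  sumTo n (λ i → g i (suc n ∸ i)) + g (suc n) (n ∸ n)
    ≡⟨ cong₂ _+_ (sumTo-cong n (λ i i≤n → cong (g i) (ℕP.+-∸-assoc 1 i≤n)))
                 (trans (cong (g (suc n)) (ℕP.n∸n≡0 n)) (g0≡0 (suc n))) ⟩
  sumTo n (λ i → g i (suc (n ∸ i))) + 0ℚ
    ≡⟨ +-identityʳ _ ⟩
  sumTo n (λ i → g i (suc (n ∸ i))) ∎

infix 4 _≈ₚ_

_≈ₚ_ : Poly → Poly → Set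
p ≈ₚ q = ∀ k → p k ≡ q k

shiftₚ : Poly → Poly
shiftₚ p zero    = 0ℚ
shiftₚ p (suc k) = p k

x+1*ₚ_ : Poly → Poly
x+1*ₚ p = shiftₚ p +ₚ p

*ₚ-congˡ : ∀ {p p′} q → p ≈ₚ p′ → (p *ₚ q) ≈ₚ (p′ *ₚ q)
*ₚ-congˡ q p≈p′ k = sumTo-cong k (λ i _ → cong (_* q (k ∸ i)) (p≈p′ i))

*ₚ-congʳ : ∀ p {q q′} → q ≈ₚ q′ → (p *ₚ q) ≈ₚ (p *ₚ q′)
*ₚ-congʳ p q≈q′ k = sumTo-cong k (λ i _ → cong (p i *_) (q≈q′ (k ∸ i)))

*ₚ-distribˡ-+ₚ : ∀ p q r → (p *ₚ (q +ₚ r)) ≈ₚ ((p *ₚ q) +ₚ (p *ₚ r))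
*ₚ-distribˡ-+ₚ p q r k =
  trans (sumTo-cong k (λ i _ → *-distribˡ-+ (p i) (q (k ∸ i)) (r (k ∸ i))))
        (sumTo-+ k (λ i → p i * q (k ∸ i)) (λ i → p i * r (k ∸ i)))

*ₚ-distribʳ-+ₚ : ∀ p q r → ((p +ₚ q) *ₚ r) ≈ₚ ((p *ₚ r) +ₚ (q *ₚ r))
*ₚ-distribʳ-+ₚ p q r k =
  trans (sumTo-cong k (λ i _ → *-distribʳ-+ (r (k ∸ i)) (p i) (q i)))
        (sumTo-+ k (λ i → p i * r (k ∸ i)) (λ i → q i * r (k ∸ i)))

*ₚ-constant : ∀ q c p → q 0 ≡ c → (∀ j → q (suc j) ≡ 0ℚ) → (q *ₚ p) ≈ₚ (λ k → c * p k)
*ₚ-constant q c p q0≡c _     zero    = cong (_* p 0) q0≡c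
*ₚ-constant q c p q0≡c q+≡0 (suc k) = begin
  (q *ₚ p) (suc k)                                  ≡⟨ sumTo-suc k (λ i → q i * p (suc k ∸ i)) ⟩
  q 0 * p (suc k) + sumTo k (λ i → q (suc i) * p (k ∸ i))
    ≡⟨ cong₂ _+_ (cong (_* p (suc k)) q0≡c)
                 (sumTo-zero k (λ i _ → trans (cong (_* p (k ∸ i)) (q+≡0 i)) (*-zeroˡ (p (k ∸ i))))) ⟩
  c * p (suc k) + 0ℚ                                ≡⟨ +-identityʳ _ ⟩
  c * p (suc k)                                     ∎

*ₚ-identityˡ : ∀ p → (oneₚ *ₚ p) ≈ₚ p
*ₚ-identityˡ p k = trans (*ₚ-constant oneₚ 1ℚ p refl (λ _ → refl) k) (*-identityˡ (p k))

sumTo-shiftₚ : ∀ n (h : ℕ → Poly) →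
               (λ k → sumTo n (λ i → shiftₚ (h i) k)) ≈ₚ shiftₚ (λ k → sumTo n (λ i → h i k))
sumTo-shiftₚ n h zero    = sumTo-zero n (λ _ _ → refl)
sumTo-shiftₚ n h (suc k) = refl

shiftₚ-*ₚ : ∀ p q → (shiftₚ p *ₚ q) ≈ₚ shiftₚ (p *ₚ q)
shiftₚ-*ₚ p q zero    = *-zeroˡ (q 0)
shiftₚ-*ₚ p q (suc k) = sumTo-suc-0 k _ (*-zeroˡ (q (suc k)))

*ₚ-shiftₚ : ∀ p q → (p *ₚ shiftₚ q) ≈ₚ shiftₚ (p *ₚ q)
*ₚ-shiftₚ p q zero    = *-zeroʳ (p 0)
*ₚ-shiftₚ p q (suc k) = sumTo-∸-suc k (λ i j → p i * shiftₚ q j) (λ i → *-zeroʳ (p i))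

xₚ-*ₚ : ∀ p → (xₚ *ₚ p) ≈ₚ shiftₚ p
xₚ-*ₚ p k = begin
  (xₚ *ₚ p) k           ≡⟨ *ₚ-congˡ p xₚ≈shiftₚ-oneₚ k ⟩
  (shiftₚ oneₚ *ₚ p) k  ≡⟨ shiftₚ-*ₚ oneₚ p k ⟩
  shiftₚ (oneₚ *ₚ p) k  ≡⟨ shiftₚ-cong (*ₚ-identityˡ p) k ⟩
  shiftₚ p k            ∎
  where
  xₚ≈shiftₚ-oneₚ : xₚ ≈ₚ shiftₚ oneₚ
  xₚ≈shiftₚ-oneₚ zero          = refl
  xₚ≈shiftₚ-oneₚ (suc zero)    = refl
  xₚ≈shiftₚ-oneₚ (suc (suc k)) = refl
  shiftₚ-cong : ∀ {q q′} → q ≈ₚ q′ → shiftₚ q ≈ₚ shiftₚ q′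
  shiftₚ-cong q≈q′ zero    = refl
  shiftₚ-cong q≈q′ (suc k) = q≈q′ k

x+1-*ₚ : ∀ p → ((xₚ +ₚ oneₚ) *ₚ p) ≈ₚ (x+1*ₚ p)
x+1-*ₚ p k =
  trans (*ₚ-distribʳ-+ₚ xₚ oneₚ p k) (cong₂ _+_ (xₚ-*ₚ p k) (*ₚ-identityˡ p k))

*ₚ-x+1*ₚ : ∀ p q → (p *ₚ (x+1*ₚ q)) ≈ₚ ((x+1*ₚ p) *ₚ q)
*ₚ-x+1*ₚ p q k = begin
  (p *ₚ (x+1*ₚ q)) k                  ≡⟨ *ₚ-distribˡ-+ₚ p (shiftₚ q) q k ⟩
  (p *ₚ shiftₚ q) k + (p *ₚ q) k      ≡⟨ cong (_+ (p *ₚ q) k) (trans (*ₚ-shiftₚ p q k) (sym (shiftₚ-*ₚ p q k))) ⟩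
  (shiftₚ p *ₚ q) k + (p *ₚ q) k      ≡⟨ sym (*ₚ-distribʳ-+ₚ (shiftₚ p) p q k) ⟩
  ((x+1*ₚ p) *ₚ q) k                  ∎

xₚ^ₚ-substCoefficient-< : ∀ m {j} → j < m → (xₚ ^ₚ m) j ≡ 0ℚ
xₚ^ₚ-substCoefficient-< (suc m) {j} j<1+m = trans (xₚ-*ₚ (xₚ ^ₚ m) j) (shifted j j<1+m)
  where
  shifted : ∀ j → j < suc m → shiftₚ (xₚ ^ₚ m) j ≡ 0ℚ
  shifted zero    _           = refl
  shifted (suc j) (s≤s j<m)   = xₚ^ₚ-substCoefficient-< m j<m

*ₚ-xₚ^ₚ-substCoefficient-< : ∀ p m {k} → k < m → (p *ₚ (xₚ ^ₚ m)) k ≡ 0ℚ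
*ₚ-xₚ^ₚ-substCoefficient-< p m {k} k<m = sumTo-zero k (λ i _ →
  trans (cong (p i *_) (xₚ^ₚ-substCoefficient-< m (ℕP.≤-<-trans (ℕP.m∸n≤m k i) k<m))) (*-zeroʳ (p i)))

x+1^ₚ-substCoefficient-0 : ∀ m → ((xₚ +ₚ oneₚ) ^ₚ m) 0 ≡ 1ℚ
x+1^ₚ-substCoefficient-0 zero    = refl
x+1^ₚ-substCoefficient-0 (suc m) =
  trans (x+1-*ₚ ((xₚ +ₚ oneₚ) ^ₚ m) 0) (trans (+-identityˡ _) (x+1^ₚ-substCoefficient-0 m))

*ₚ-cancelʳ-≤ : ∀ n {p q e} → e 0 ≡ 1ℚ → (∀ k → k ≤ n → (p *ₚ e) k ≡ (q *ₚ e) k) →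
               ∀ k → k ≤ n → p k ≡ q k
*ₚ-cancelʳ-≤ n {p} {q} {e} e0≡1 pe≡qe k k≤n = agree k k≤n ℕP.≤-refl
  where
  unit : ∀ r → r * e 0 ≡ r
  unit r = trans (cong (r *_) e0≡1) (*-identityʳ r)

  last : ∀ r k → (r *ₚ e) (suc k) ≡ sumTo k (λ i → r i * e (suc k ∸ i)) + r (suc k)
  last r k = cong (sumTo k (λ i → r i * e (suc k ∸ i)) +_)
                  (trans (cong (λ j → r (suc k) * e j) (ℕP.n∸n≡0 k)) (unit (r (suc k))))

  agree : ∀ k → k ≤ n → ∀ {i} → i ≤ k → p i ≡ q i
  agree zero    _   z≤n = trans (sym (unit (p 0))) (trans (pe≡qe 0 z≤n) (unit (q 0)))
  agree (suc k) k<n {i} i≤1+k with ℕP.m≤n⇒m<n∨m≡n i≤1+k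
  ... | inj₁ (s≤s i≤k) = agree k (ℕP.<⇒≤ k<n) i≤k
  ... | inj₂ refl      = ∙-cancelˡ (sumTo k (λ i → p i * e (suc k ∸ i))) (p (suc k)) (q (suc k)) (begin
    sumTo k (λ i → p i * e (suc k ∸ i)) + p (suc k) ≡⟨ sym (last p k) ⟩
    (p *ₚ e) (suc k)                                ≡⟨ pe≡qe (suc k) k<n ⟩
    (q *ₚ e) (suc k)                                ≡⟨ last q k ⟩
    sumTo k (λ i → q i * e (suc k ∸ i)) + q (suc k) ≡⟨ cong (_+ q (suc k)) (sym lower) ⟩
    sumTo k (λ i → p i * e (suc k ∸ i)) + q (suc k) ∎)
    where
    lower : sumTo k (λ i → p i * e (suc k ∸ i)) ≡ sumTo k (λ i → q i * e (suc k ∸ i))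
    lower = sumTo-cong k (λ i i≤k → cong (_* e (suc k ∸ i)) (agree k (ℕP.<⇒≤ k<n) i≤k))

-- The explicit solution of the Bezout identity

-- negBinom m k = (-1)^k binom(m+k, k), the coefficients of (1+x)^-(m+1).
negBinom : ℕ → Poly
negBinom m       zero    = 1ℚ
negBinom zero    (suc k) = - negBinom zero k
negBinom (suc m) (suc k) = negBinom m (suc k) - negBinom (suc m) k

x+1*ₚ-negBinom-zero : (x+1*ₚ negBinom 0) ≈ₚ oneₚ
x+1*ₚ-negBinom-zero zero    = refl
x+1*ₚ-negBinom-zero (suc k) = +-inverseʳ (negBinom 0 k)

x+1*ₚ-negBinom-suc : ∀ m → (x+1*ₚ negBinom (suc m)) ≈ₚ negBinom m
x+1*ₚ-negBinom-suc m zero    = refl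
x+1*ₚ-negBinom-suc m (suc k) = a+[b-a]≡b (negBinom (suc m) k) (negBinom m (suc k))
  where
  a+[b-a]≡b : ∀ a b → a + (b - a) ≡ b
  a+[b-a]≡b = solve-∀ ℚ-ring

*ₚ-x+1^ₚ-suc : ∀ p m →
  (p *ₚ ((xₚ +ₚ oneₚ) ^ₚ suc m)) ≈ₚ ((x+1*ₚ p) *ₚ ((xₚ +ₚ oneₚ) ^ₚ m))
*ₚ-x+1^ₚ-suc p m k =
  trans (*ₚ-congʳ p (x+1-*ₚ ((xₚ +ₚ oneₚ) ^ₚ m)) k) (*ₚ-x+1*ₚ p ((xₚ +ₚ oneₚ) ^ₚ m) k)

negBinom-*ₚ-x+1^ₚ : ∀ n → (negBinom n *ₚ ((xₚ +ₚ oneₚ) ^ₚ suc n)) ≈ₚ oneₚ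
negBinom-*ₚ-x+1^ₚ zero k =
  trans (*ₚ-x+1^ₚ-suc (negBinom 0) 0 k)
        (trans (*ₚ-congˡ oneₚ x+1*ₚ-negBinom-zero k) (*ₚ-identityˡ oneₚ k))
negBinom-*ₚ-x+1^ₚ (suc n) k =
  trans (*ₚ-x+1^ₚ-suc (negBinom (suc n)) (suc n) k)
        (trans (*ₚ-congˡ ((xₚ +ₚ oneₚ) ^ₚ suc n) (x+1*ₚ-negBinom-suc n) k) (negBinom-*ₚ-x+1^ₚ n k))

truncₚ : ℕ → Poly → Poly
truncₚ n       p zero    = p zero
truncₚ zero    p (suc k) = 0ℚ
truncₚ (suc n) p (suc k) = truncₚ n (p ∘ suc) k

truncₚ-≤ : ∀ {n k} p → k ≤ n → truncₚ n p k ≡ p k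
truncₚ-≤ {n}     {zero}  p _         = refl
truncₚ-≤ {suc n} {suc k} p (s≤s k≤n) = truncₚ-≤ (p ∘ suc) k≤n

truncₚ-> : ∀ {n k} p → n < k → truncₚ n p k ≡ 0ℚ
truncₚ-> {zero}  {suc k} p _         = refl
truncₚ-> {suc n} {suc k} p (s≤s n<k) = truncₚ-> (p ∘ suc) n<k

truncₚ-*ₚ : ∀ {n k} p q → k ≤ n → (truncₚ n p *ₚ q) k ≡ (p *ₚ q) k
truncₚ-*ₚ {k = k} p q k≤n =
  sumTo-cong k (λ i i≤k → cong (_* q (k ∸ i)) (truncₚ-≤ p (ℕP.≤-trans i≤k k≤n)))

explicitQ : ℕ → Poly
explicitQ n = truncₚ n (negBinom n)

BezoutId⇒*ₚ-x+1^ₚ-≤ : ∀ n {P Q} → BezoutId n P Q →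
  ∀ k → k ≤ n → (Q *ₚ ((xₚ +ₚ oneₚ) ^ₚ suc n)) k ≡ oneₚ k
BezoutId⇒*ₚ-x+1^ₚ-≤ n {P} {Q} bezout k k≤n = begin
  (Q *ₚ E) k                          ≡⟨ sym (+-identityˡ _) ⟩
  0ℚ + (Q *ₚ E) k                     ≡⟨ cong (_+ (Q *ₚ E) k) (sym (*ₚ-xₚ^ₚ-substCoefficient-< P (suc n) (s≤s k≤n))) ⟩
  (P *ₚ (xₚ ^ₚ suc n)) k + (Q *ₚ E) k ≡⟨ bezout k ⟩
  oneₚ k                              ∎
  where E = (xₚ +ₚ oneₚ) ^ₚ suc n

IsPQ⇒≈explicitQ : ∀ n {P Q} → IsPQ n P Q → Q ≈ₚ explicitQ n
IsPQ⇒≈explicitQ n {P} {Q} (_ , degQ , bezout) k with k ℕ.≤? n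
... | yes k≤n = *ₚ-cancelʳ-≤ n {Q} {explicitQ n} {E} (x+1^ₚ-substCoefficient-0 (suc n)) agreeMod k k≤n
  where
  E = (xₚ +ₚ oneₚ) ^ₚ suc n
  agreeMod : ∀ j → j ≤ n → (Q *ₚ E) j ≡ (explicitQ n *ₚ E) j
  agreeMod j j≤n = begin
    (Q *ₚ E) j             ≡⟨ BezoutId⇒*ₚ-x+1^ₚ-≤ n {P} {Q} bezout j j≤n ⟩
    oneₚ j                 ≡⟨ sym (negBinom-*ₚ-x+1^ₚ n j) ⟩
    (negBinom n *ₚ E) j    ≡⟨ sym (truncₚ-*ₚ (negBinom n) E j≤n) ⟩
    (explicitQ n *ₚ E) j   ∎
... | no k≰n = trans (degQ k (ℕP.≰⇒> k≰n)) (sym (truncₚ-> (negBinom n) (ℕP.≰⇒> k≰n)))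

≡-modulo : ∀ {x y l r} c → x ≡ y + c * (l - r) → l ≡ r → x ≡ y
≡-modulo {y = y} {r = r} c x≡ refl = begin
  _                  ≡⟨ x≡ ⟩
  y + c * (r - r)    ≡⟨ cong (λ z → y + c * z) (+-inverseʳ r) ⟩
  y + c * 0ℚ         ≡⟨ cong (y +_) (*-zeroʳ c) ⟩
  y + 0ℚ             ≡⟨ +-identityʳ y ⟩
  y                  ∎

ℕ→ℚ≡mkℚ : ∀ n → ℕ→ℚ n ≡ mkℚ (ℤ.+ n) 0 (Coprimality.sym (Coprimality.1-coprimeTo n))
ℕ→ℚ≡mkℚ n = normalize-coprime (Coprimality.sym (Coprimality.1-coprimeTo n))

ℕ→ℚ-suc : ∀ n → ℕ→ℚ (suc n) ≡ 1ℚ + ℕ→ℚ n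
ℕ→ℚ-suc n rewrite ℕ→ℚ≡mkℚ n =
  -- the right-hand side computes to the normalisation of (1 * 1 + n * 1) / 1
  sym (/-cong {p₁ = ℤ.+ 1 ℤ.* ℤ.+ 1 ℤ.+ ℤ.+ n ℤ.* ℤ.+ 1} {q₁ = 1} {p₂ = ℤ.+ suc n} {q₂ = 1}
              (cong (λ z → ℤ.+ 1 ℤ.+ z) (ℤP.*-identityʳ (ℤ.+ n))) refl)

ℕ→ℚ-suc-*-inverse : ∀ m → ℕ→ℚ (suc m) * (ℤ.+ 1 / suc m) ≡ 1ℚ
ℕ→ℚ-suc-*-inverse m
  rewrite ℕ→ℚ≡mkℚ (suc m) | normalize-coprime (Coprimality.1-coprimeTo (suc m)) =
  *-inverseʳ (mkℚ (ℤ.+ suc m) 0 (Coprimality.sym (Coprimality.1-coprimeTo (suc m))))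

ℕ→ℚ-suc-cancelˡ : ∀ m {p q} → ℕ→ℚ (suc m) * p ≡ ℕ→ℚ (suc m) * q → p ≡ q
ℕ→ℚ-suc-cancelˡ m {p} {q} Mp≡Mq = begin
  p            ≡⟨ sym (unscale p) ⟩
  I * (M * p)  ≡⟨ cong (I *_) Mp≡Mq ⟩
  I * (M * q)  ≡⟨ unscale q ⟩
  q            ∎
  where
  M = ℕ→ℚ (suc m)
  I = ℤ.+ 1 / suc m
  unscale : ∀ r → I * (M * r) ≡ r
  unscale r = begin
    I * (M * r)  ≡⟨ sym (*-assoc I M r) ⟩
    (I * M) * r  ≡⟨ cong (_* r) (trans (*-comm I M) (ℕ→ℚ-suc-*-inverse m)) ⟩
    1ℚ * r       ≡⟨ *-identityˡ r ⟩
    r            ∎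

-- Binomial identities

negBinom-1-k : ∀ k → negBinom 1 k ≡ ℕ→ℚ (suc k) * negBinom 0 k
negBinom-1-k zero    = refl
negBinom-1-k (suc k) = begin
  negBinom 0 (suc k) - negBinom 1 k    ≡⟨ cong (λ z → negBinom 0 (suc k) - z) (negBinom-1-k k) ⟩
  - b - K * b                          ≡⟨ regroup K b ⟩
  (1ℚ + K) * (- b)                     ≡⟨ cong (_* (- b)) (sym (ℕ→ℚ-suc (suc k))) ⟩
  ℕ→ℚ (suc (suc k)) * negBinom 0 (suc k) ∎
  where
  K = ℕ→ℚ (suc k)
  b = negBinom 0 k
  regroup : ∀ K b → - b - K * b ≡ (1ℚ + K) * (- b)
  regroup = solve-∀ ℚ-ring

negBinom-m-1 : ∀ m → negBinom m 1 ≡ - ℕ→ℚ (suc m)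
negBinom-m-1 zero    = refl
negBinom-m-1 (suc m) = begin
  negBinom m 1 - 1ℚ         ≡⟨ cong (_- 1ℚ) (negBinom-m-1 m) ⟩
  - M - 1ℚ                  ≡⟨ regroup M ⟩
  - (1ℚ + M)                ≡⟨ cong -_ (sym (ℕ→ℚ-suc (suc m))) ⟩
  - ℕ→ℚ (suc (suc m))       ∎
  where
  M = ℕ→ℚ (suc m)
  regroup : ∀ M → - M - 1ℚ ≡ - (1ℚ + M)
  regroup = solve-∀ ℚ-ring

negBinom-absorption : ∀ m k →
  ℕ→ℚ (suc k) * negBinom m (suc k) + ℕ→ℚ (suc m) * negBinom (suc m) k ≡ 0ℚ
negBinom-absorption zero k = begin
  K * (- b) + ℕ→ℚ 1 * negBinom 1 k   ≡⟨ cong (λ z → K * (- b) + ℕ→ℚ 1 * z) (negBinom-1-k k) ⟩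
  K * (- b) + ℕ→ℚ 1 * (K * b)        ≡⟨ cancels K b ⟩
  0ℚ                                 ∎
  where
  K = ℕ→ℚ (suc k)
  b = negBinom 0 k
  cancels : ∀ K b → K * (- b) + ℕ→ℚ 1 * (K * b) ≡ 0ℚ
  cancels = solve-∀ ℚ-ring
negBinom-absorption (suc m) zero = begin
  ℕ→ℚ 1 * negBinom (suc m) 1 + M * 1ℚ  ≡⟨ cong (λ z → ℕ→ℚ 1 * z + M * 1ℚ) (negBinom-m-1 (suc m)) ⟩
  ℕ→ℚ 1 * (- M) + M * 1ℚ               ≡⟨ cancels M ⟩
  0ℚ                                   ∎
  where
  M = ℕ→ℚ (suc (suc m))
  cancels : ∀ M → ℕ→ℚ 1 * (- M) + M * 1ℚ ≡ 0ℚ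
  cancels = solve-∀ ℚ-ring
negBinom-absorption (suc m) (suc k) =
  pascal {K = ℕ→ℚ (suc k)} {M = ℕ→ℚ (suc m)} (ℕ→ℚ-suc (suc k)) (ℕ→ℚ-suc (suc m))
         (negBinom-absorption m (suc k)) (negBinom-absorption (suc m) k)
  where
  pascal : ∀ {K K′ M M′ u v w} → K′ ≡ 1ℚ + K → M′ ≡ 1ℚ + M →
           K′ * u + M * v ≡ 0ℚ → K * v + M′ * w ≡ 0ℚ → K′ * (u - v) + M′ * (v - w) ≡ 0ℚ
  pascal {K} {_} {M} {_} {u} {v} {w} refl refl h₁ h₂ = begin
    (1ℚ + K) * (u - v) + (1ℚ + M) * (v - w)                   ≡⟨ split K M u v w ⟩
    ((1ℚ + K) * u + M * v) - (K * v + (1ℚ + M) * w)           ≡⟨ cong₂ _-_ h₁ h₂ ⟩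
    0ℚ - 0ℚ                                                   ≡⟨ refl ⟩
    0ℚ                                                        ∎
    where
    split : ∀ K M u v w → (1ℚ + K) * (u - v) + (1ℚ + M) * (v - w)
                          ≡ ((1ℚ + K) * u + M * v) - (K * v + (1ℚ + M) * w)
    split = solve-∀ ℚ-ring

negBinom-antisym : ∀ m → negBinom (suc m) m ≡ - negBinom m (suc m)
negBinom-antisym m = inverseʳ-unique (negBinom m (suc m)) (negBinom (suc m) m)
  (ℕ→ℚ-suc-cancelˡ m (begin
    M * (negBinom m (suc m) + negBinom (suc m) m)            ≡⟨ *-distribˡ-+ M _ _ ⟩
    M * negBinom m (suc m) + M * negBinom (suc m) m          ≡⟨ negBinom-absorption m m ⟩
    0ℚ                                                       ≡⟨ sym (*-zeroʳ M) ⟩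
    M * 0ℚ                                                   ∎))
  where M = ℕ→ℚ (suc m)

negBinom-suc-ratio : ∀ m k → ℕ→ℚ (suc m) * negBinom (suc m) k ≡ (ℕ→ℚ (suc m) + ℕ→ℚ k) * negBinom m k
negBinom-suc-ratio m zero    = trivial (ℕ→ℚ (suc m))
  where
  trivial : ∀ M → M * 1ℚ ≡ (M + ℕ→ℚ 0) * 1ℚ
  trivial = solve-∀ ℚ-ring
negBinom-suc-ratio m (suc k) = ≡-modulo (- 1ℚ) (identity M K u v) (negBinom-absorption m k)
  where
  M = ℕ→ℚ (suc m)
  K = ℕ→ℚ (suc k)
  u = negBinom m (suc k)
  v = negBinom (suc m) k
  identity : ∀ M K u v → M * (u - v) ≡ (M + K) * u + (- 1ℚ) * ((K * u + M * v) - 0ℚ)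
  identity = solve-∀ ℚ-ring

-- central n = (-1)^n binom(2n, n), the substCoefficienticient of (xt)^n in 1/sqrt(1+4xt).
central : ℕ → ℚ
central n = negBinom n n

central-suc-ratio : ∀ m →
  ℕ→ℚ (suc m) * central (suc m) ≡ - (ℕ→ℚ 2 * (ℕ→ℚ (suc m) + ℕ→ℚ m)) * central m
central-suc-ratio m = begin
  M * (u - v)                   ≡⟨ cong (λ z → M * (u - z)) (negBinom-antisym m) ⟩
  M * (u - - u)                 ≡⟨ double M u ⟩
  - (ℕ→ℚ 2 * (M * - u))
    ≡⟨ cong (λ z → - (ℕ→ℚ 2 * z)) (trans (cong (M *_) (sym (negBinom-antisym m))) (negBinom-suc-ratio m m)) ⟩
  - (ℕ→ℚ 2 * ((M + N) * central m)) ≡⟨ reassoc (M + N) (central m) ⟩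
  - (ℕ→ℚ 2 * (M + N)) * central m ∎
  where
  M = ℕ→ℚ (suc m)
  N = ℕ→ℚ m
  u = negBinom m (suc m)
  v = negBinom (suc m) m
  double : ∀ M u → M * (u - - u) ≡ - (ℕ→ℚ 2 * (M * - u))
  double = solve-∀ ℚ-ring
  reassoc : ∀ a c → - (ℕ→ℚ 2 * (a * c)) ≡ - (ℕ→ℚ 2 * a) * c
  reassoc = solve-∀ ℚ-ring

sqrtCoeff : ℕ → ℚ
sqrtCoeff n = gbinom ½ n * (ℕ→ℚ 4 ^ℚ n)

sqrtCoeff-suc-ratio : ∀ m → ℕ→ℚ (suc m) * sqrtCoeff (suc m) ≡ ℕ→ℚ 4 * (½ - ℕ→ℚ m) * sqrtCoeff m
sqrtCoeff-suc-ratio m = begin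
  M * (g * (½ - N) * I * (ℕ→ℚ 4 * p))    ≡⟨ regroup M I g N p ⟩
  (M * I) * (ℕ→ℚ 4 * (½ - N) * (g * p))  ≡⟨ cong (_* (ℕ→ℚ 4 * (½ - N) * (g * p))) (ℕ→ℚ-suc-*-inverse m) ⟩
  1ℚ * (ℕ→ℚ 4 * (½ - N) * (g * p))      ≡⟨ *-identityˡ _ ⟩
  ℕ→ℚ 4 * (½ - N) * (g * p)             ∎
  where
  M = ℕ→ℚ (suc m)
  N = ℕ→ℚ m
  I = ℤ.+ 1 / suc m
  g = gbinom ½ m
  p = ℕ→ℚ 4 ^ℚ m
  regroup : ∀ M I g N p → M * (g * (½ - N) * I * (ℕ→ℚ 4 * p)) ≡ (M * I) * (ℕ→ℚ 4 * (½ - N) * (g * p))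
  regroup = solve-∀ ℚ-ring

sqrtCoeff-central : ∀ n → sqrtCoeff (suc n) ≡ central (suc n) + ℕ→ℚ 4 * central n
sqrtCoeff-central zero    = refl
-- Multiplied by n+2, both sides equal 2 central (n+1).
sqrtCoeff-central (suc n) = ℕ→ℚ-suc-cancelˡ (suc n) (begin
  M₂ * sqrtCoeff (suc (suc n))              ≡⟨ sqrtCoeff-suc-ratio (suc n) ⟩
  ℕ→ℚ 4 * (½ - M₁) * sqrtCoeff (suc n)      ≡⟨ cong (ℕ→ℚ 4 * (½ - M₁) *_) (sqrtCoeff-central n) ⟩
  ℕ→ℚ 4 * (½ - M₁) * (c₁ + ℕ→ℚ 4 * c₀)      ≡⟨ lower (ℕ→ℚ-suc n) (central-suc-ratio n) ⟩
  ℕ→ℚ 2 * c₁                                ≡⟨ upper (ℕ→ℚ-suc (suc n)) (central-suc-ratio (suc n)) ⟨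
  M₂ * (c₂ + ℕ→ℚ 4 * c₁)                    ∎)
  where
  M₁ = ℕ→ℚ (suc n)
  M₂ = ℕ→ℚ (suc (suc n))
  c₀ = central n
  c₁ = central (suc n)
  c₂ = central (suc (suc n))
  lower : ∀ {N M a b} → M ≡ 1ℚ + N → M * a ≡ - (ℕ→ℚ 2 * (M + N)) * b →
          ℕ→ℚ 4 * (½ - M) * (a + ℕ→ℚ 4 * b) ≡ ℕ→ℚ 2 * a
  lower {N} {a = a} {b} refl = ≡-modulo (- ℕ→ℚ 4) (identity N a b)
    where
    identity : ∀ N a b → ℕ→ℚ 4 * (½ - (1ℚ + N)) * (a + ℕ→ℚ 4 * b)
               ≡ ℕ→ℚ 2 * a + (- ℕ→ℚ 4) * ((1ℚ + N) * a - - (ℕ→ℚ 2 * ((1ℚ + N) + N)) * b)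
    identity = solve-∀ ℚ-ring
  upper : ∀ {N M a b} → M ≡ 1ℚ + N → M * a ≡ - (ℕ→ℚ 2 * (M + N)) * b →
          M * (a + ℕ→ℚ 4 * b) ≡ ℕ→ℚ 2 * b
  upper {N} {a = a} {b} refl = ≡-modulo 1ℚ (identity N a b)
    where
    identity : ∀ N a b → (1ℚ + N) * (a + ℕ→ℚ 4 * b)
               ≡ ℕ→ℚ 2 * b + 1ℚ * ((1ℚ + N) * a - - (ℕ→ℚ 2 * ((1ℚ + N) + N)) * b)
    identity = solve-∀ ℚ-ring

-- Power series in t and x

shiftₜ : Ser → Ser
shiftₜ F zero    k = 0ℚ
shiftₜ F (suc n) k = F n k

shiftₓ : Ser → Ser
shiftₓ F n = shiftₚ (F n)

infixr 25 _·ₛ_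

_·ₛ_ : ℚ → Ser → Ser
(c ·ₛ F) n k = c * F n k

+ₛ-cong : ∀ {F F′ G G′} → F ≈ₛ F′ → G ≈ₛ G′ → (F +ₛ G) ≈ₛ (F′ +ₛ G′)
+ₛ-cong F≈F′ G≈G′ n k = cong₂ _+_ (F≈F′ n k) (G≈G′ n k)

·ₛ-cong : ∀ c {F F′} → F ≈ₛ F′ → (c ·ₛ F) ≈ₛ (c ·ₛ F′)
·ₛ-cong c F≈F′ n k = cong (c *_) (F≈F′ n k)

negₛ-cong : ∀ {F F′} → F ≈ₛ F′ → negₛ F ≈ₛ negₛ F′
negₛ-cong F≈F′ n k = cong -_ (F≈F′ n k)

shiftₜ-cong : ∀ {F F′} → F ≈ₛ F′ → shiftₜ F ≈ₛ shiftₜ F′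
shiftₜ-cong F≈F′ zero    k = refl
shiftₜ-cong F≈F′ (suc n) k = F≈F′ n k

shiftₓ-cong : ∀ {F F′} → F ≈ₛ F′ → shiftₓ F ≈ₛ shiftₓ F′
shiftₓ-cong F≈F′ n zero    = refl
shiftₓ-cong F≈F′ n (suc k) = F≈F′ n k

shiftₜ-+ₛ : ∀ F G → shiftₜ (F +ₛ G) ≈ₛ (shiftₜ F +ₛ shiftₜ G)
shiftₜ-+ₛ F G zero    k = refl
shiftₜ-+ₛ F G (suc n) k = refl

shiftₓ-+ₛ : ∀ F G → shiftₓ (F +ₛ G) ≈ₛ (shiftₓ F +ₛ shiftₓ G)
shiftₓ-+ₛ F G n zero    = refl
shiftₓ-+ₛ F G n (suc k) = refl

shiftₜ-·ₛ : ∀ c F → shiftₜ (c ·ₛ F) ≈ₛ (c ·ₛ shiftₜ F)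
shiftₜ-·ₛ c F zero    k = sym (*-zeroʳ c)
shiftₜ-·ₛ c F (suc n) k = refl

shiftₓ-·ₛ : ∀ c F → shiftₓ (c ·ₛ F) ≈ₛ (c ·ₛ shiftₓ F)
shiftₓ-·ₛ c F n zero    = sym (*-zeroʳ c)
shiftₓ-·ₛ c F n (suc k) = refl

shiftₜ-negₛ : ∀ F → shiftₜ (negₛ F) ≈ₛ negₛ (shiftₜ F)
shiftₜ-negₛ F zero    k = refl
shiftₜ-negₛ F (suc n) k = refl

shiftₓ-negₛ : ∀ F → shiftₓ (negₛ F) ≈ₛ negₛ (shiftₓ F)
shiftₓ-negₛ F n zero    = refl
shiftₓ-negₛ F n (suc k) = refl

shiftₓ-shiftₜ : ∀ F → shiftₓ (shiftₜ F) ≈ₛ shiftₜ (shiftₓ F)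
shiftₓ-shiftₜ F zero    zero    = refl
shiftₓ-shiftₜ F zero    (suc k) = refl
shiftₓ-shiftₜ F (suc n) k       = refl

*ₛ-congˡ : ∀ {F F′} G → F ≈ₛ F′ → (F *ₛ G) ≈ₛ (F′ *ₛ G)
*ₛ-congˡ G F≈F′ n k = sumTo-cong n (λ i _ → *ₚ-congˡ (G (n ∸ i)) (F≈F′ i) k)

*ₛ-congʳ : ∀ F {G G′} → G ≈ₛ G′ → (F *ₛ G) ≈ₛ (F *ₛ G′)
*ₛ-congʳ F G≈G′ n k = sumTo-cong n (λ i _ → *ₚ-congʳ (F i) (G≈G′ (n ∸ i)) k)

*ₛ-distribʳ-+ₛ : ∀ F G H → ((F +ₛ G) *ₛ H) ≈ₛ ((F *ₛ H) +ₛ (G *ₛ H))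
*ₛ-distribʳ-+ₛ F G H n k =
  trans (sumTo-cong n (λ i _ → *ₚ-distribʳ-+ₚ (F i) (G i) (H (n ∸ i)) k))
        (sumTo-+ n (λ i → (F i *ₚ H (n ∸ i)) k) (λ i → (G i *ₚ H (n ∸ i)) k))

·ₛ-*ₛ : ∀ c F G → ((c ·ₛ F) *ₛ G) ≈ₛ (c ·ₛ (F *ₛ G))
·ₛ-*ₛ c F G n k = trans (sumTo-cong n (λ i _ → inner i)) (sumTo-*ˡ n c (λ i → (F i *ₚ G (n ∸ i)) k))
  where
  inner : ∀ i → sumTo k (λ j → (c * F i j) * G (n ∸ i) (k ∸ j)) ≡ c * (F i *ₚ G (n ∸ i)) k
  inner i = trans (sumTo-cong k (λ j _ → *-assoc c (F i j) (G (n ∸ i) (k ∸ j))))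
                  (sumTo-*ˡ k c (λ j → F i j * G (n ∸ i) (k ∸ j)))

negₛ-*ₛ : ∀ F G → (negₛ F *ₛ G) ≈ₛ negₛ (F *ₛ G)
negₛ-*ₛ F G n k = trans (sumTo-cong n (λ i _ → inner i)) (sumTo-neg n (λ i → (F i *ₚ G (n ∸ i)) k))
  where
  inner : ∀ i → sumTo k (λ j → - F i j * G (n ∸ i) (k ∸ j)) ≡ - (F i *ₚ G (n ∸ i)) k
  inner i = trans (sumTo-cong k (λ j _ → sym (neg-distribˡ-* (F i j) (G (n ∸ i) (k ∸ j)))))
                  (sumTo-neg k (λ j → F i j * G (n ∸ i) (k ∸ j)))

constₛ-*ₛ : ∀ c F → (constₛ c *ₛ F) ≈ₛ (c ·ₛ F)
constₛ-*ₛ c F zero    k = *ₚ-constant (constₛ c 0) c (F 0) refl (λ _ → refl) k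
constₛ-*ₛ c F (suc n) k = begin
  (constₛ c *ₛ F) (suc n) k
    ≡⟨ sumTo-suc n (λ i → (constₛ c i *ₚ F (suc n ∸ i)) k) ⟩
  (constₛ c 0 *ₚ F (suc n)) k + sumTo n (λ i → sumTo k (λ j → 0ℚ * F (n ∸ i) (k ∸ j)))
    ≡⟨ cong₂ _+_ (*ₚ-constant (constₛ c 0) c (F (suc n)) refl (λ _ → refl) k)
                 (sumTo-zero n (λ i _ → sumTo-zero k (λ j _ → *-zeroˡ (F (n ∸ i) (k ∸ j))))) ⟩
  c * F (suc n) k + 0ℚ
    ≡⟨ +-identityʳ _ ⟩
  c * F (suc n) k ∎

constₛ-1-*ₛ : ∀ F → (constₛ 1ℚ *ₛ F) ≈ₛ F
constₛ-1-*ₛ F n k = trans (constₛ-*ₛ 1ℚ F n k) (*-identityˡ (F n k))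

shiftₜ-*ₛ : ∀ F G → (shiftₜ F *ₛ G) ≈ₛ shiftₜ (F *ₛ G)
shiftₜ-*ₛ F G zero    k = sumTo-zero k (λ j _ → *-zeroˡ (G 0 (k ∸ j)))
shiftₜ-*ₛ F G (suc n) k =
  sumTo-suc-0 n (λ i → (shiftₜ F i *ₚ G (suc n ∸ i)) k)
              (sumTo-zero k (λ j _ → *-zeroˡ (G (suc n) (k ∸ j))))

shiftₓ-*ₛ : ∀ F G → (shiftₓ F *ₛ G) ≈ₛ shiftₓ (F *ₛ G)
shiftₓ-*ₛ F G n k =
  trans (sumTo-cong n (λ i _ → shiftₚ-*ₚ (F i) (G (n ∸ i)) k))
        (sumTo-shiftₚ n (λ i → F i *ₚ G (n ∸ i)) k)

xₛ≈shiftₓ-1 : xₛ ≈ₛ shiftₓ (constₛ 1ℚ)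
xₛ≈shiftₓ-1 zero    zero          = refl
xₛ≈shiftₓ-1 zero    (suc zero)    = refl
xₛ≈shiftₓ-1 zero    (suc (suc k)) = refl
xₛ≈shiftₓ-1 (suc n) zero          = refl
xₛ≈shiftₓ-1 (suc n) (suc k)       = refl

xₛ-*ₛ : ∀ F → (xₛ *ₛ F) ≈ₛ shiftₓ F
xₛ-*ₛ F n k = begin
  (xₛ *ₛ F) n k                   ≡⟨ *ₛ-congˡ F xₛ≈shiftₓ-1 n k ⟩
  (shiftₓ (constₛ 1ℚ) *ₛ F) n k   ≡⟨ shiftₓ-*ₛ (constₛ 1ℚ) F n k ⟩
  shiftₓ (constₛ 1ℚ *ₛ F) n k     ≡⟨ shiftₓ-cong (constₛ-1-*ₛ F) n k ⟩
  shiftₓ F n k                    ∎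

tₛ≈shiftₜ-1 : tₛ ≈ₛ shiftₜ (constₛ 1ℚ)
tₛ≈shiftₜ-1 zero          k       = refl
tₛ≈shiftₜ-1 (suc zero)    zero    = refl
tₛ≈shiftₜ-1 (suc zero)    (suc k) = refl
tₛ≈shiftₜ-1 (suc (suc n)) k       = refl

tₛ-*ₛ : ∀ F → (tₛ *ₛ F) ≈ₛ shiftₜ F
tₛ-*ₛ F n k = begin
  (tₛ *ₛ F) n k                   ≡⟨ *ₛ-congˡ F tₛ≈shiftₜ-1 n k ⟩
  (shiftₜ (constₛ 1ℚ) *ₛ F) n k   ≡⟨ shiftₜ-*ₛ (constₛ 1ℚ) F n k ⟩
  shiftₜ (constₛ 1ℚ *ₛ F) n k     ≡⟨ shiftₜ-cong (constₛ-1-*ₛ F) n k ⟩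
  shiftₜ F n k                    ∎

infixr 25 [1+x-t]·_ [1+4xt]·_ [1+2x]·_

[1+x-t]·_ : Ser → Ser
[1+x-t]· F = (F +ₛ shiftₓ F) +ₛ negₛ (shiftₜ F)

[1+4xt]·_ : Ser → Ser
[1+4xt]· F = F +ₛ (ℕ→ℚ 4 ·ₛ shiftₓ (shiftₜ F))

[1+2x]·_ : Ser → Ser
[1+2x]· F = F +ₛ (ℕ→ℚ 2 ·ₛ shiftₓ F)

[1+x-t]·-cong : ∀ {F F′} → F ≈ₛ F′ → [1+x-t]· F ≈ₛ [1+x-t]· F′
[1+x-t]·-cong F≈F′ = +ₛ-cong (+ₛ-cong F≈F′ (shiftₓ-cong F≈F′)) (negₛ-cong (shiftₜ-cong F≈F′))

[1+4xt]·-cong : ∀ {F F′} → F ≈ₛ F′ → [1+4xt]· F ≈ₛ [1+4xt]· F′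
[1+4xt]·-cong F≈F′ = +ₛ-cong F≈F′ (·ₛ-cong (ℕ→ℚ 4) (shiftₓ-cong (shiftₜ-cong F≈F′)))

[1+2x]·-cong : ∀ {F F′} → F ≈ₛ F′ → [1+2x]· F ≈ₛ [1+2x]· F′
[1+2x]·-cong F≈F′ = +ₛ-cong F≈F′ (·ₛ-cong (ℕ→ℚ 2) (shiftₓ-cong F≈F′))

1+x-t-*ₛ : ∀ F → (((constₛ 1ℚ +ₛ xₛ) +ₛ negₛ tₛ) *ₛ F) ≈ₛ [1+x-t]· F
1+x-t-*ₛ F n k = begin
  (((constₛ 1ℚ +ₛ xₛ) +ₛ negₛ tₛ) *ₛ F) n k
    ≡⟨ *ₛ-distribʳ-+ₛ (constₛ 1ℚ +ₛ xₛ) (negₛ tₛ) F n k ⟩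
  ((constₛ 1ℚ +ₛ xₛ) *ₛ F) n k + (negₛ tₛ *ₛ F) n k
    ≡⟨ cong₂ _+_ (trans (*ₛ-distribʳ-+ₛ (constₛ 1ℚ) xₛ F n k)
                        (cong₂ _+_ (constₛ-1-*ₛ F n k) (xₛ-*ₛ F n k)))
                 (trans (negₛ-*ₛ tₛ F n k) (cong -_ (tₛ-*ₛ F n k))) ⟩
  ([1+x-t]· F) n k ∎

[1+x-t]·-*ₛ : ∀ F G → (([1+x-t]· F) *ₛ G) ≈ₛ [1+x-t]· (F *ₛ G)
[1+x-t]·-*ₛ F G n k = begin
  (((F +ₛ shiftₓ F) +ₛ negₛ (shiftₜ F)) *ₛ G) n k
    ≡⟨ *ₛ-distribʳ-+ₛ (F +ₛ shiftₓ F) (negₛ (shiftₜ F)) G n k ⟩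
  ((F +ₛ shiftₓ F) *ₛ G) n k + (negₛ (shiftₜ F) *ₛ G) n k
    ≡⟨ cong₂ _+_ (trans (*ₛ-distribʳ-+ₛ F (shiftₓ F) G n k) (cong ((F *ₛ G) n k +_) (shiftₓ-*ₛ F G n k)))
                 (trans (negₛ-*ₛ (shiftₜ F) G n k) (cong -_ (shiftₜ-*ₛ F G n k))) ⟩
  ([1+x-t]· (F *ₛ G)) n k ∎

xₛtₛ-*ₛ : ∀ F → ((xₛ *ₛ tₛ) *ₛ F) ≈ₛ shiftₓ (shiftₜ F)
xₛtₛ-*ₛ F n k = begin
  ((xₛ *ₛ tₛ) *ₛ F) n k    ≡⟨ *ₛ-congˡ F (xₛ-*ₛ tₛ) n k ⟩
  (shiftₓ tₛ *ₛ F) n k     ≡⟨ shiftₓ-*ₛ tₛ F n k ⟩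
  shiftₓ (tₛ *ₛ F) n k     ≡⟨ shiftₓ-cong (tₛ-*ₛ F) n k ⟩
  shiftₓ (shiftₜ F) n k    ∎

one+4xt-*ₛ : ∀ F → (one+4xt *ₛ F) ≈ₛ [1+4xt]· F
one+4xt-*ₛ F n k = begin
  (one+4xt *ₛ F) n k
    ≡⟨ *ₛ-distribʳ-+ₛ (constₛ 1ℚ) (constₛ (ℕ→ℚ 4) *ₛ (xₛ *ₛ tₛ)) F n k ⟩
  (constₛ 1ℚ *ₛ F) n k + ((constₛ (ℕ→ℚ 4) *ₛ (xₛ *ₛ tₛ)) *ₛ F) n k
    ≡⟨ cong₂ _+_ (constₛ-1-*ₛ F n k) (begin
         ((constₛ (ℕ→ℚ 4) *ₛ (xₛ *ₛ tₛ)) *ₛ F) n k  ≡⟨ *ₛ-congˡ F (constₛ-*ₛ (ℕ→ℚ 4) (xₛ *ₛ tₛ)) n k ⟩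
         ((ℕ→ℚ 4 ·ₛ (xₛ *ₛ tₛ)) *ₛ F) n k           ≡⟨ ·ₛ-*ₛ (ℕ→ℚ 4) (xₛ *ₛ tₛ) F n k ⟩
         ℕ→ℚ 4 * ((xₛ *ₛ tₛ) *ₛ F) n k              ≡⟨ cong (ℕ→ℚ 4 *_) (xₛtₛ-*ₛ F n k) ⟩
         ℕ→ℚ 4 * shiftₓ (shiftₜ F) n k              ∎) ⟩
  ([1+4xt]· F) n k ∎

one+4xt≈ : one+4xt ≈ₛ [1+4xt]· constₛ 1ℚ
one+4xt≈ n k = cong (constₛ 1ℚ n k +_) (begin
  (constₛ (ℕ→ℚ 4) *ₛ (xₛ *ₛ tₛ)) n k         ≡⟨ constₛ-*ₛ (ℕ→ℚ 4) (xₛ *ₛ tₛ) n k ⟩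
  ℕ→ℚ 4 * (xₛ *ₛ tₛ) n k                     ≡⟨ cong (ℕ→ℚ 4 *_) (xₛ-*ₛ tₛ n k) ⟩
  ℕ→ℚ 4 * shiftₓ tₛ n k                      ≡⟨ cong (ℕ→ℚ 4 *_) (shiftₓ-cong tₛ≈shiftₜ-1 n k) ⟩
  ℕ→ℚ 4 * shiftₓ (shiftₜ (constₛ 1ℚ)) n k    ∎)

1+2x-*ₛ : ∀ F → ((constₛ 1ℚ +ₛ (constₛ (ℕ→ℚ 2) *ₛ xₛ)) *ₛ F) ≈ₛ [1+2x]· F
1+2x-*ₛ F n k = begin
  ((constₛ 1ℚ +ₛ (constₛ (ℕ→ℚ 2) *ₛ xₛ)) *ₛ F) n k
    ≡⟨ *ₛ-distribʳ-+ₛ (constₛ 1ℚ) (constₛ (ℕ→ℚ 2) *ₛ xₛ) F n k ⟩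
  (constₛ 1ℚ *ₛ F) n k + ((constₛ (ℕ→ℚ 2) *ₛ xₛ) *ₛ F) n k
    ≡⟨ cong₂ _+_ (constₛ-1-*ₛ F n k) (begin
         ((constₛ (ℕ→ℚ 2) *ₛ xₛ) *ₛ F) n k  ≡⟨ *ₛ-congˡ F (constₛ-*ₛ (ℕ→ℚ 2) xₛ) n k ⟩
         ((ℕ→ℚ 2 ·ₛ xₛ) *ₛ F) n k           ≡⟨ ·ₛ-*ₛ (ℕ→ℚ 2) xₛ F n k ⟩
         ℕ→ℚ 2 * (xₛ *ₛ F) n k              ≡⟨ cong (ℕ→ℚ 2 *_) (xₛ-*ₛ F n k) ⟩
         ℕ→ℚ 2 * shiftₓ F n k               ∎) ⟩
  ([1+2x]· F) n k ∎

denom-*ₛ : ∀ F → (denom *ₛ F) ≈ₛ (ℕ→ℚ 2 ·ₛ [1+x-t]· [1+4xt]· F)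
denom-*ₛ F n k = begin
  (denom *ₛ F) n k                            ≡⟨ *ₛ-congˡ F (constₛ-*ₛ (ℕ→ℚ 2) (A *ₛ one+4xt)) n k ⟩
  ((ℕ→ℚ 2 ·ₛ (A *ₛ one+4xt)) *ₛ F) n k        ≡⟨ ·ₛ-*ₛ (ℕ→ℚ 2) (A *ₛ one+4xt) F n k ⟩
  ℕ→ℚ 2 * ((A *ₛ one+4xt) *ₛ F) n k           ≡⟨ cong (ℕ→ℚ 2 *_) (begin
    ((A *ₛ one+4xt) *ₛ F) n k                   ≡⟨ *ₛ-congˡ F (1+x-t-*ₛ one+4xt) n k ⟩
    (([1+x-t]· one+4xt) *ₛ F) n k               ≡⟨ [1+x-t]·-*ₛ one+4xt F n k ⟩
    ([1+x-t]· (one+4xt *ₛ F)) n k               ≡⟨ [1+x-t]·-cong (one+4xt-*ₛ F) n k ⟩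
    ([1+x-t]· [1+4xt]· F) n k                   ∎) ⟩
  ℕ→ℚ 2 * ([1+x-t]· [1+4xt]· F) n k           ∎
  where A = (constₛ 1ℚ +ₛ xₛ) +ₛ negₛ tₛ

numer≈ : numer ≈ₛ ([1+4xt]· constₛ 1ℚ +ₛ [1+2x]· sqrt1+4xt)
numer≈ = +ₛ-cong one+4xt≈ (1+2x-*ₛ sqrt1+4xt)

shiftₓshiftₜ-+ₛ : ∀ F G → shiftₓ (shiftₜ (F +ₛ G)) ≈ₛ (shiftₓ (shiftₜ F) +ₛ shiftₓ (shiftₜ G))
shiftₓshiftₜ-+ₛ F G n k = trans (shiftₓ-cong (shiftₜ-+ₛ F G) n k) (shiftₓ-+ₛ (shiftₜ F) (shiftₜ G) n k)

shiftₓshiftₜ-·ₛ : ∀ c F → shiftₓ (shiftₜ (c ·ₛ F)) ≈ₛ c ·ₛ shiftₓ (shiftₜ F)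
shiftₓshiftₜ-·ₛ c F n k = trans (shiftₓ-cong (shiftₜ-·ₛ c F) n k) (shiftₓ-·ₛ c (shiftₜ F) n k)

shiftₓshiftₜ-negₛ : ∀ F → shiftₓ (shiftₜ (negₛ F)) ≈ₛ negₛ (shiftₓ (shiftₜ F))
shiftₓshiftₜ-negₛ F n k = trans (shiftₓ-cong (shiftₜ-negₛ F) n k) (shiftₓ-negₛ (shiftₜ F) n k)

[1+4xt]·-+ₛ : ∀ F G → [1+4xt]· (F +ₛ G) ≈ₛ ([1+4xt]· F +ₛ [1+4xt]· G)
[1+4xt]·-+ₛ F G n k =
  trans (cong (λ z → (F n k + G n k) + ℕ→ℚ 4 * z) (shiftₓshiftₜ-+ₛ F G n k))
        (interchange (F n k) (G n k) (shiftₓ (shiftₜ F) n k) (shiftₓ (shiftₜ G) n k))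
  where
  interchange : ∀ a b c d → (a + b) + ℕ→ℚ 4 * (c + d) ≡ (a + ℕ→ℚ 4 * c) + (b + ℕ→ℚ 4 * d)
  interchange = solve-∀ ℚ-ring

[1+4xt]·-·ₛ : ∀ c F → [1+4xt]· (c ·ₛ F) ≈ₛ c ·ₛ [1+4xt]· F
[1+4xt]·-·ₛ c F n k =
  trans (cong (λ z → c * F n k + ℕ→ℚ 4 * z) (shiftₓshiftₜ-·ₛ c F n k))
        (factor c (F n k) (shiftₓ (shiftₜ F) n k))
  where
  factor : ∀ c a b → c * a + ℕ→ℚ 4 * (c * b) ≡ c * (a + ℕ→ℚ 4 * b)
  factor = solve-∀ ℚ-ring

[1+x-t]·-[1+4xt]· : ∀ F → [1+x-t]· [1+4xt]· F ≈ₛ [1+4xt]· [1+x-t]· F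
[1+x-t]·-[1+4xt]· F n k = begin
  (([1+4xt]· F) n k + shiftₓ ([1+4xt]· F) n k) + - shiftₜ ([1+4xt]· F) n k
    ≡⟨ cong₂ (λ u v → (([1+4xt]· F) n k + u) + - v)
             (trans (shiftₓ-+ₛ F (ℕ→ℚ 4 ·ₛ shiftₓ (shiftₜ F)) n k) (cong (shiftₓ F n k +_) (shiftₓ-·ₛ (ℕ→ℚ 4) (shiftₓ (shiftₜ F)) n k)))
             (trans (shiftₜ-+ₛ F (ℕ→ℚ 4 ·ₛ shiftₓ (shiftₜ F)) n k) (cong (shiftₜ F n k +_) (shiftₜ-·ₛ (ℕ→ℚ 4) (shiftₓ (shiftₜ F)) n k))) ⟩
  ((a + ℕ→ℚ 4 * b) + (c + ℕ→ℚ 4 * d)) + - (e + ℕ→ℚ 4 * f)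
    ≡⟨ regroup a b c d e f ⟩
  ((a + c) + - e) + ℕ→ℚ 4 * ((b + d) + - f)
    ≡⟨ cong₂ (λ u v → ((a + c) + - e) + ℕ→ℚ 4 * ((b + u) + - v))
             (shiftₓ-cong (shiftₓ-shiftₜ F) n k) (sym (shiftₓ-shiftₜ (shiftₜ F) n k)) ⟩
  ((a + c) + - e) + ℕ→ℚ 4 * ((b + shiftₓ (shiftₜ (shiftₓ F)) n k) + - shiftₓ (shiftₜ (shiftₜ F)) n k)
    ≡⟨ cong (λ u → ((a + c) + - e) + ℕ→ℚ 4 * u) (sym (trans
         (shiftₓshiftₜ-+ₛ (F +ₛ shiftₓ F) (negₛ (shiftₜ F)) n k)
         (cong₂ _+_ (shiftₓshiftₜ-+ₛ F (shiftₓ F) n k) (shiftₓshiftₜ-negₛ (shiftₜ F) n k)))) ⟩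
  ([1+4xt]· [1+x-t]· F) n k ∎
  where
  a = F n k
  b = shiftₓ (shiftₜ F) n k
  c = shiftₓ F n k
  d = shiftₓ (shiftₓ (shiftₜ F)) n k
  e = shiftₜ F n k
  f = shiftₜ (shiftₓ (shiftₜ F)) n k
  regroup : ∀ a b c d e f → ((a + ℕ→ℚ 4 * b) + (c + ℕ→ℚ 4 * d)) + - (e + ℕ→ℚ 4 * f)
                            ≡ ((a + c) + - e) + ℕ→ℚ 4 * ((b + d) + - f)
  regroup = solve-∀ ℚ-ring

[1+4xt]·-[1+2x]· : ∀ F → [1+4xt]· [1+2x]· F ≈ₛ [1+2x]· [1+4xt]· F
[1+4xt]·-[1+2x]· F n k = begin
  ([1+2x]· F) n k + ℕ→ℚ 4 * shiftₓ (shiftₜ ([1+2x]· F)) n k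
    ≡⟨ cong (λ u → ([1+2x]· F) n k + ℕ→ℚ 4 * u)
            (trans (shiftₓshiftₜ-+ₛ F (ℕ→ℚ 2 ·ₛ shiftₓ F) n k) (cong (b +_) (shiftₓshiftₜ-·ₛ (ℕ→ℚ 2) (shiftₓ F) n k))) ⟩
  (a + ℕ→ℚ 2 * c) + ℕ→ℚ 4 * (b + ℕ→ℚ 2 * shiftₓ (shiftₜ (shiftₓ F)) n k)
    ≡⟨ cong (λ u → (a + ℕ→ℚ 2 * c) + ℕ→ℚ 4 * (b + ℕ→ℚ 2 * u)) (sym (shiftₓ-cong (shiftₓ-shiftₜ F) n k)) ⟩
  (a + ℕ→ℚ 2 * c) + ℕ→ℚ 4 * (b + ℕ→ℚ 2 * d)
    ≡⟨ regroup a b c d ⟩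
  (a + ℕ→ℚ 4 * b) + ℕ→ℚ 2 * (c + ℕ→ℚ 4 * d)
    ≡⟨ cong (λ u → (a + ℕ→ℚ 4 * b) + ℕ→ℚ 2 * u)
            (sym (trans (shiftₓ-+ₛ F (ℕ→ℚ 4 ·ₛ shiftₓ (shiftₜ F)) n k) (cong (c +_) (shiftₓ-·ₛ (ℕ→ℚ 4) (shiftₓ (shiftₜ F)) n k)))) ⟩
  ([1+2x]· [1+4xt]· F) n k ∎
  where
  a = F n k
  b = shiftₓ (shiftₜ F) n k
  c = shiftₓ F n k
  d = shiftₓ (shiftₓ (shiftₜ F)) n k
  regroup : ∀ a b c d → (a + ℕ→ℚ 2 * c) + ℕ→ℚ 4 * (b + ℕ→ℚ 2 * d) ≡ (a + ℕ→ℚ 4 * b) + ℕ→ℚ 2 * (c + ℕ→ℚ 4 * d)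
  regroup = solve-∀ ℚ-ring

diagₛ : (ℕ → ℚ) → Ser
diagₛ a n k with n ℕ.≟ k
... | yes _ = a n
... | no  _ = 0ℚ

diagₛ-≡ : ∀ a {n k} → n ≡ k → diagₛ a n k ≡ a n
diagₛ-≡ a {n} refl with n ℕ.≟ n
... | yes _   = refl
... | no  n≢n = ⊥-elim (n≢n refl)

diagₛ-≢ : ∀ a {n k} → n ≢ k → diagₛ a n k ≡ 0ℚ
diagₛ-≢ a {n} {k} n≢k with n ℕ.≟ k
... | yes n≡k = ⊥-elim (n≢k n≡k)
... | no  _   = refl

sqrt1+4xt≈diagₛ : sqrt1+4xt ≈ₛ diagₛ sqrtCoeff
sqrt1+4xt≈diagₛ n k with n ℕ.≟ k
... | yes _ = refl
... | no  _ = refl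

[1+4xt]·-diagₛ : ∀ {a c} → a 0 ≡ c 0 → (∀ m → a (suc m) + ℕ→ℚ 4 * a m ≡ c (suc m)) →
                 [1+4xt]· diagₛ a ≈ₛ diagₛ c
[1+4xt]·-diagₛ {a} a0≡c0 step zero    zero    = trans (+-identityʳ (a 0)) a0≡c0
[1+4xt]·-diagₛ a0≡c0 step zero    (suc k) = refl
[1+4xt]·-diagₛ a0≡c0 step (suc n) zero    = refl
[1+4xt]·-diagₛ {a} {c} a0≡c0 step (suc n) (suc k) = onDiagonal? (n ℕ.≟ k)
  where
  onDiagonal? : Dec (n ≡ k) → diagₛ a (suc n) (suc k) + ℕ→ℚ 4 * diagₛ a n k ≡ diagₛ c (suc n) (suc k)
  onDiagonal? (yes n≡k) = begin
    diagₛ a (suc n) (suc k) + ℕ→ℚ 4 * diagₛ a n k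
      ≡⟨ cong₂ (λ u v → u + ℕ→ℚ 4 * v) (diagₛ-≡ a (cong suc n≡k)) (diagₛ-≡ a n≡k) ⟩
    a (suc n) + ℕ→ℚ 4 * a n        ≡⟨ step n ⟩
    c (suc n)                      ≡⟨ diagₛ-≡ c (cong suc n≡k) ⟨
    diagₛ c (suc n) (suc k)        ∎
  onDiagonal? (no n≢k) = begin
    diagₛ a (suc n) (suc k) + ℕ→ℚ 4 * diagₛ a n k
      ≡⟨ cong₂ (λ u v → u + ℕ→ℚ 4 * v) (diagₛ-≢ a (n≢k ∘ ℕP.suc-injective)) (diagₛ-≢ a n≢k) ⟩
    0ℚ                             ≡⟨ diagₛ-≢ c (n≢k ∘ ℕP.suc-injective) ⟨
    diagₛ c (suc n) (suc k)        ∎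

[1+4xt]·-central : [1+4xt]· diagₛ central ≈ₛ sqrt1+4xt
[1+4xt]·-central n k =
  trans ([1+4xt]·-diagₛ refl (λ m → sym (sqrtCoeff-central m)) n k) (sym (sqrt1+4xt≈diagₛ n k))

-- The shape of the coefficient of t^(m+1) x^(j+1) in  2 (1+x-t) G = 1 + (1+2x) D.
substCoefficient : ∀ {g₁ g₂ g₃ d₁ d₂ g₁′ g₂′ g₃′ d₁′ d₂′} →
                   g₁ ≡ g₁′ → g₂ ≡ g₂′ → g₃ ≡ g₃′ → d₁ ≡ d₁′ → d₂ ≡ d₂′ →
                   ℕ→ℚ 2 * ((g₁′ + g₂′) + - g₃′) ≡ 0ℚ + (d₁′ + ℕ→ℚ 2 * d₂′) →
                   ℕ→ℚ 2 * ((g₁ + g₂) + - g₃) ≡ 0ℚ + (d₁ + ℕ→ℚ 2 * d₂)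
substCoefficient refl refl refl refl refl e = e

-- Away from the diagonal, Pascal's rule for negBinom cancels the coefficients of (1+x-t) G.
explicitQ-[1+x-t] : ℕ→ℚ 2 ·ₛ [1+x-t]· explicitQ ≈ₛ (constₛ 1ℚ +ₛ [1+2x]· diagₛ central)
explicitQ-[1+x-t] zero    zero                = refl
explicitQ-[1+x-t] zero    (suc zero)          = refl
explicitQ-[1+x-t] zero    (suc (suc k))       = refl
explicitQ-[1+x-t] (suc m) zero                = refl
explicitQ-[1+x-t] (suc m) (suc j) with ℕP.<-cmp j m
... | tri< j<m _ _ =
  substCoefficient
    (truncₚ-≤ (negBinom (suc m) ∘ suc) (ℕP.<⇒≤ j<m))
    (truncₚ-≤ (negBinom (suc m)) (ℕP.m≤n⇒m≤1+n (ℕP.<⇒≤ j<m)))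
    (truncₚ-≤ (negBinom m) j<m)
    (diagₛ-≢ central (λ e → ℕP.<⇒≢ j<m (sym (ℕP.suc-injective e))))
    (diagₛ-≢ central (λ e → ℕP.<⇒≢ (ℕP.m<n⇒m<1+n j<m) (sym e)))
    (interior (negBinom m (suc j)) (negBinom (suc m) j))
  where
  interior : ∀ u v → ℕ→ℚ 2 * (((u - v) + v) + - u) ≡ 0ℚ + (0ℚ + ℕ→ℚ 2 * 0ℚ)
  interior = solve-∀ ℚ-ring
... | tri≈ _ refl _ =
  substCoefficient
    (trans (truncₚ-≤ {j} (negBinom (suc j) ∘ suc) ℕP.≤-refl) (cong (λ v → u - v) antisym))
    (trans (truncₚ-≤ {suc j} (negBinom (suc j)) (ℕP.n≤1+n j)) antisym)
    (truncₚ-> {j} (negBinom j) ℕP.≤-refl)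
    (trans (diagₛ-≡ central {suc j} refl) (cong (λ v → u - v) antisym))
    (diagₛ-≢ central {suc j} ℕP.1+n≢n)
    (diagonal u)
  where
  u = negBinom j (suc j)
  antisym = negBinom-antisym j
  diagonal : ∀ u → ℕ→ℚ 2 * (((u - - u) + - u) + - 0ℚ) ≡ 0ℚ + ((u - - u) + ℕ→ℚ 2 * 0ℚ)
  diagonal = solve-∀ ℚ-ring
... | tri> _ _ m<j with ℕP.<-cmp j (suc m)
...   | tri< j<1+m _ _ = ⊥-elim (ℕP.<-irrefl refl (ℕP.<-≤-trans m<j (ℕP.≤-pred j<1+m)))
...   | tri≈ _ refl _ =
  substCoefficient
    (truncₚ-> {m} (negBinom (suc m) ∘ suc) ℕP.≤-refl)
    (truncₚ-≤ {suc m} (negBinom (suc m)) ℕP.≤-refl)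
    (truncₚ-> {m} (negBinom m) (ℕP.m<n⇒m<1+n ℕP.≤-refl))
    (diagₛ-≢ central {suc m} (ℕP.1+n≢n ∘ sym))
    (diagₛ-≡ central {suc m} refl)
    (above (central (suc m)))
  where
  above : ∀ c → ℕ→ℚ 2 * ((0ℚ + c) + - 0ℚ) ≡ 0ℚ + (0ℚ + ℕ→ℚ 2 * c)
  above = solve-∀ ℚ-ring
...   | tri> _ _ 1+m<j =
  substCoefficient
    (truncₚ-> (negBinom (suc m) ∘ suc) m<j)
    (truncₚ-> (negBinom (suc m)) 1+m<j)
    (truncₚ-> (negBinom m) (ℕP.m<n⇒m<1+n m<j))
    (diagₛ-≢ central (λ e → ℕP.<⇒≢ m<j (ℕP.suc-injective e)))
    (diagₛ-≢ central (ℕP.<⇒≢ 1+m<j))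
        refl

proposition2p12 : (P Q : ℕ → Poly) → (∀ n → IsPQ n (P n) (Q n)) →
    (denom *ₛ genFun Q) ≈ₛ numer
proposition2p12 P Q isPQ n k = begin
  (denom *ₛ genFun Q) n k                           ≡⟨ *ₛ-congʳ denom (λ m → IsPQ⇒≈explicitQ m (isPQ m)) n k ⟩
  (denom *ₛ explicitQ) n k                          ≡⟨ denom-*ₛ explicitQ n k ⟩
  (ℕ→ℚ 2 ·ₛ [1+x-t]· [1+4xt]· explicitQ) n k        ≡⟨ ·ₛ-cong (ℕ→ℚ 2) ([1+x-t]·-[1+4xt]· explicitQ) n k ⟩
  (ℕ→ℚ 2 ·ₛ [1+4xt]· [1+x-t]· explicitQ) n k        ≡⟨ [1+4xt]·-·ₛ (ℕ→ℚ 2) ([1+x-t]· explicitQ) n k ⟨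
  ([1+4xt]· ℕ→ℚ 2 ·ₛ [1+x-t]· explicitQ) n k        ≡⟨ [1+4xt]·-cong explicitQ-[1+x-t] n k ⟩
  ([1+4xt]· (constₛ 1ℚ +ₛ [1+2x]· Δ)) n k           ≡⟨ [1+4xt]·-+ₛ (constₛ 1ℚ) ([1+2x]· Δ) n k ⟩
  ([1+4xt]· constₛ 1ℚ +ₛ [1+4xt]· [1+2x]· Δ) n k    ≡⟨ cong (([1+4xt]· constₛ 1ℚ) n k +_) ([1+4xt]·-[1+2x]· Δ n k) ⟩
  ([1+4xt]· constₛ 1ℚ +ₛ [1+2x]· [1+4xt]· Δ) n k    ≡⟨ cong (([1+4xt]· constₛ 1ℚ) n k +_) ([1+2x]·-cong [1+4xt]·-central n k) ⟩
  ([1+4xt]· constₛ 1ℚ +ₛ [1+2x]· sqrt1+4xt) n k     ≡⟨ numer≈ n k ⟨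
  numer n k                                         ∎
  where Δ = diagₛ central
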